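{- If a graph $G$ contains a hammock, then $\operatorname{fdom}(G)\le 5/2$.
   Context: Graphs are finite and simple. A suspended $k$-path in $G$ is a path of length $k$ (i.e. with $k$ edges) whose two endpoints are distinct and have degree at least $3$ in $G$, and whose inner vertices have degree exactly $2$ in $G$. A hammock in $G$ is the union of a suspended $2$-path and a suspended $3$-path between the same two non-adjacent vertices. For integers $0<q\le p$, a dominating $(p:q)$-colouring of $G$ is a map $\phi\colon V(G)\to\binom{[p]}{q}$ with $\bigcup_{u\in N[v]}\phi(u)=[p]$ for every vertex $v$ ($N[v]$ the closed neighbourhood); $\operatorname{fdom}(G)$ is the maximum of $p/q$ over such colourings. -}

module Defs where

open import Data.Nat using (ℕ; zero; suc; _≤_; _*_)
open import Data.Fin using (Fin; zero; suc; fromℕ; inject₁)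
open import Data.Fin.Subset using (Subset; _∈_; ∣_∣)
open import Data.Vec using (tabulate)
open import Data.Bool using (Bool; true; false)
open import Data.Product using (Σ; ∃; _×_; _,_)
open import Data.Sum using (_⊎_)
open import Relation.Binary.PropositionalEquality using (_≡_; _≢_)
open import Relation.Nullary using (¬_)
open import Function.Definitions using (Injective)

record Graph : Set where
  field
    n      : ℕ
    adj    : Fin n → Fin n → Bool
    sym    : ∀ u v → adj u v ≡ adj v u
    irrefl : ∀ v → adj v v ≡ false

module _ (G : Graph) where
  open Graph G

  Adj : Fin n → Fin n → Set
  Adj u v = adj u v ≡ true

  deg : Fin n → ℕ
  deg v = ∣ tabulate (adj v) ∣

  record SuspendedPath (k : ℕ) (x y : Fin n) : Set where
    field
      vtx       : Fin (suc k) → Fin n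
      distinct  : Injective _≡_ _≡_ vtx
      start     : vtx zero ≡ x
      end       : vtx (fromℕ k) ≡ y
      edges     : ∀ (i : Fin k) → Adj (vtx (inject₁ i)) (vtx (suc i))
      ends≢     : x ≢ y
      degx      : 3 ≤ deg x
      degy      : 3 ≤ deg y
      inner     : ∀ (i : Fin (suc k)) → vtx i ≢ x → vtx i ≢ y → deg (vtx i) ≡ 2

  HasHammock : Set
  HasHammock = Σ (Fin n) λ x → Σ (Fin n) λ y →
    ¬ Adj x y × SuspendedPath 2 x y × SuspendedPath 3 x y

  record DomColouring (p q : ℕ) : Set where
    field
      col       : Fin n → Subset p
      size      : ∀ v → ∣ col v ∣ ≡ q
      dominates : ∀ (v : Fin n) (c : Fin p) →
                  ∃ λ u → (u ≡ v ⊎ Adj v u) × c ∈ col u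

  -- fdom(G) ≤ a/b, i.e. every dominating (p:q)-colouring with 0<q≤p has p/q ≤ a/b.
  FdomAtMost : ℕ → ℕ → Set
  FdomAtMost a b = ∀ (p q : ℕ) → 1 ≤ q → q ≤ p → DomColouring p q → p * b ≤ a * q

-- The two inner vertices b, c of the suspended 3-path and the inner vertex a of
-- the suspended 2-path have degree 2, so their closed neighbourhoods are
-- {b,x,c}, {c,b,y} and {a,x,y}. Every colour must occur in each of these three
-- sets, and no vertex lies in all three, so every colour is used at least twice
-- on the five vertices a, x, y, b, c. Double counting gives 2p ≤ 5q.
module Submission where

open import Defs
open import Algebra.Properties.CommutativeSemigroup using (x∙yz≈y∙xz)
open import Data.Bool using (Bool; true; false; T; _∨_)
open import Data.Bool.Properties using (T-∨; T-≡)
open import Data.Fin using (Fin; zero; suc; fromℕ; inject₁; _≟_)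
open import Data.Fin.Subset using (Subset; _∈_; _-_; ∣_∣; inside; outside)
open import Data.Fin.Subset.Properties using (x∈p⇒∣p-x∣<∣p∣; x∈p∧x≢y⇒x∈p-y)
open import Data.Nat using (zero; suc; _≤_; _*_; _+_; z≤n; s≤s)
open import Data.Nat.Properties
  using (≤-trans; +-mono-≤; +-commutativeSemigroup; module ≤-Reasoning)
open import Data.Product using (_,_)
open import Data.Sum as Sum using (_⊎_; inj₁; inj₂)
open import Data.Vec using (Vec; []; _∷_; lookup; map; tail; sum; tabulate)
open import Data.Vec.Properties using (lookup⇒[]=; []=⇒lookup; lookup∘tabulate)
open import Function using (_∘_)
open import Function.Bundles using (Equivalence)
open import Relation.Binary.PropositionalEquality
  using (_≡_; _≢_; refl; sym; trans; cong; cong₂; subst)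
open import Relation.Nullary using (yes; no)

open Equivalence using (from)

three-members⇒3≤∣p∣ : ∀ {m} {p : Subset m} {x y z} → x ≢ y → x ≢ z → y ≢ z →
                      x ∈ p → y ∈ p → z ∈ p → 3 ≤ ∣ p ∣
three-members⇒3≤∣p∣ {p = p} {x} {y} {z} x≢y x≢z y≢z x∈p y∈p z∈p = begin
  3                 ≤⟨ s≤s (s≤s (≤-trans (s≤s z≤n) (x∈p⇒∣p-x∣<∣p∣ x∈p-z-y))) ⟩
  2 + ∣ p - z - y ∣ ≤⟨ s≤s (x∈p⇒∣p-x∣<∣p∣ (x∈p∧x≢y⇒x∈p-y y∈p y≢z)) ⟩
  1 + ∣ p - z ∣     ≤⟨ x∈p⇒∣p-x∣<∣p∣ z∈p ⟩
  ∣ p ∣             ∎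
  where
  open ≤-Reasoning
  x∈p-z-y : x ∈ p - z - y
  x∈p-z-y = x∈p∧x≢y⇒x∈p-y (x∈p∧x≢y⇒x∈p-y x∈p x≢z) x≢y

∈⇒T : ∀ {m} {S : Subset m} {i} → i ∈ S → T (lookup S i)
∈⇒T = from T-≡ ∘ []=⇒lookup

∈-one-of⇒T∨ : ∀ {m} {S₁ S₂ S₃ : Subset m} {i} → i ∈ S₁ ⊎ i ∈ S₂ ⊎ i ∈ S₃ →
              T (lookup S₁ i ∨ lookup S₂ i ∨ lookup S₃ i)
∈-one-of⇒T∨ {S₁ = S₁} {S₂} {i = i} =
  from (T-∨ {lookup S₁ i}) ∘ Sum.map ∈⇒T (from (T-∨ {lookup S₂ i}) ∘ Sum.map ∈⇒T ∈⇒T)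

-- Reading Ss as the rows of a k × p incidence matrix, column i lists which Ss contain i.
column : ∀ {p k} → Fin p → Vec (Subset p) k → Subset k
column i = map (λ S → lookup S i)

column-suc : ∀ {p k} (i : Fin p) (Ss : Vec (Subset (suc p)) k) →
             column (suc i) Ss ≡ column i (map tail Ss)
column-suc i []             = refl
column-suc i ((_ ∷ S) ∷ Ss) = cong (lookup S i ∷_) (column-suc i Ss)

sum-sizes-split : ∀ {p k} (Ss : Vec (Subset (suc p)) k) →
                  sum (map ∣_∣ Ss) ≡ ∣ column zero Ss ∣ + sum (map ∣_∣ (map tail Ss))
sum-sizes-regroup : ∀ {p k} (S : Subset p) (Ss : Vec (Subset (suc p)) k) →
  ∣ S ∣ + sum (map ∣_∣ Ss) ≡ ∣ column zero Ss ∣ + (∣ S ∣ + sum (map ∣_∣ (map tail Ss)))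
sum-sizes-split []                   = refl
sum-sizes-split ((inside  ∷ S) ∷ Ss) = cong suc (sum-sizes-regroup S Ss)
sum-sizes-split ((outside ∷ S) ∷ Ss) = sum-sizes-regroup S Ss

sum-sizes-regroup S Ss = trans (cong (∣ S ∣ +_) (sum-sizes-split Ss))
  (x∙yz≈y∙xz +-commutativeSemigroup ∣ S ∣ ∣ column zero Ss ∣ (sum (map ∣_∣ (map tail Ss))))

double-counting : ∀ {p k} m (Ss : Vec (Subset p) k) →
                  (∀ i → m ≤ ∣ column i Ss ∣) → p * m ≤ sum (map ∣_∣ Ss)
double-counting {zero}  m Ss covered = z≤n
double-counting {suc p} m Ss covered = begin
  m + p * m                                          ≤⟨ +-mono-≤ (covered zero) tails-bound ⟩
  ∣ column zero Ss ∣ + sum (map ∣_∣ (map tail Ss))   ≡⟨ sym (sum-sizes-split Ss) ⟩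
  sum (map ∣_∣ Ss)                                   ∎
  where
  open ≤-Reasoning
  tails-bound : p * m ≤ sum (map ∣_∣ (map tail Ss))
  tails-bound = double-counting m (map tail Ss)
    (λ i → subst (λ C → m ≤ ∣ C ∣) (column-suc i Ss) (covered (suc i)))

-- No position lies in all three triples {a,x,y}, {b,x,c}, {c,b,y}.
covered-twice : ∀ a x y b c → T (a ∨ x ∨ y) → T (b ∨ x ∨ c) → T (c ∨ b ∨ y) →
                2 ≤ ∣ a ∷ x ∷ y ∷ b ∷ c ∷ [] ∣
covered-twice true  true  _     _     _     _  _  _  = s≤s (s≤s z≤n)
covered-twice true  false true  _     _     _  _  _  = s≤s (s≤s z≤n)
covered-twice true  false false true  _     _  _  _  = s≤s (s≤s z≤n)
covered-twice true  false false false true  _  _  _  = s≤s (s≤s z≤n)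
covered-twice true  false false false false _  () _
covered-twice false true  true  _     _     _  _  _  = s≤s (s≤s z≤n)
covered-twice false true  false true  _     _  _  _  = s≤s (s≤s z≤n)
covered-twice false true  false false true  _  _  _  = s≤s (s≤s z≤n)
covered-twice false true  false false false _  _  ()
covered-twice false false false _     _     () _  _
covered-twice false false true  true  _     _  _  _  = s≤s (s≤s z≤n)
covered-twice false false true  false true  _  _  _  = s≤s (s≤s z≤n)
covered-twice false false true  false false _  () _

module _ (G : Graph) where
  open Graph G using (n; adj)

  Adj-sym : ∀ {u v} → Adj G u v → Adj G v u
  Adj-sym {u} {v} uv = trans (Graph.sym G v u) uv

  Adj⇒∈neighbourhood : ∀ {v u} → Adj G v u → u ∈ tabulate (adj v)
  Adj⇒∈neighbourhood {v} {u} vu = lookup⇒[]= u _ (trans (lookup∘tabulate (adj v) u) vu)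

  degree-two-neighbours : ∀ {v u w t} → deg G v ≡ 2 → Adj G v u → Adj G v w → u ≢ w →
                          Adj G v t → t ≡ u ⊎ t ≡ w
  degree-two-neighbours {t = t} deg≡2 vu vw u≢w vt with t ≟ _ | t ≟ _
  ... | yes t≡u | _       = inj₁ t≡u
  ... | no  _   | yes t≡w = inj₂ t≡w
  ... | no  t≢u | no  t≢w
    with subst (3 ≤_) deg≡2 (three-members⇒3≤∣p∣ u≢w (t≢u ∘ sym) (t≢w ∘ sym)
           (Adj⇒∈neighbourhood vu) (Adj⇒∈neighbourhood vw) (Adj⇒∈neighbourhood vt))
  ... | s≤s (s≤s ())

  module _ {k x y} (P : SuspendedPath G k x y) where
    open SuspendedPath P

    vtx-≢-start : ∀ {i} → i ≢ zero → vtx i ≢ x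
    vtx-≢-start i≢0 vtx≡x = i≢0 (distinct (trans vtx≡x (sym start)))

    vtx-≢-end : ∀ {i} → i ≢ fromℕ k → vtx i ≢ y
    vtx-≢-end i≢k vtx≡y = i≢k (distinct (trans vtx≡y (sym end)))

    inner-degree : ∀ {i} → i ≢ zero → i ≢ fromℕ k → deg G (vtx i) ≡ 2
    inner-degree i≢0 i≢k = inner _ (vtx-≢-start i≢0) (vtx-≢-end i≢k)

  module _ {k x y} (P : SuspendedPath G (suc k) x y) where
    open SuspendedPath P

    first-edge : Adj G (vtx (suc zero)) x
    first-edge = Adj-sym (subst (λ v → Adj G v (vtx (suc zero))) start (edges zero))

    last-edge : Adj G (vtx (inject₁ (fromℕ k))) y
    last-edge = subst (Adj G _) end (edges (fromℕ k))

  hammock-vertices : ∀ {x y} → SuspendedPath G 2 x y → SuspendedPath G 3 x y → Vec (Fin n) 5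
  hammock-vertices {x} {y} P₂ P₃ =
    vtx P₂ (suc zero) ∷ x ∷ y ∷ vtx P₃ (suc zero) ∷ vtx P₃ (suc (suc zero)) ∷ []
    where open SuspendedPath

  module _ {p q} (D : DomColouring G p q) where
    open DomColouring D

    degree-two-covers : ∀ {v u w} → deg G v ≡ 2 → Adj G v u → Adj G v w → u ≢ w →
                        ∀ i → i ∈ col v ⊎ i ∈ col u ⊎ i ∈ col w
    degree-two-covers {v} deg≡2 vu vw u≢w i with dominates v i
    ... | _ , inj₁ refl , i∈col = inj₁ i∈col
    ... | _ , inj₂ vt   , i∈col with degree-two-neighbours deg≡2 vu vw u≢w vt
    ...   | inj₁ refl = inj₂ (inj₁ i∈col)
    ...   | inj₂ refl = inj₂ (inj₂ i∈col)

    sum-sizes : ∀ {k} (vs : Vec (Fin n) k) → sum (map ∣_∣ (map col vs)) ≡ k * q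
    sum-sizes []       = refl
    sum-sizes (v ∷ vs) = cong₂ _+_ (size v) (sum-sizes vs)

    hammock-covered-twice : ∀ {x y} (P₂ : SuspendedPath G 2 x y) (P₃ : SuspendedPath G 3 x y) →
                            ∀ i → 2 ≤ ∣ column i (map col (hammock-vertices P₂ P₃)) ∣
    hammock-covered-twice {x} {y} P₂ P₃ i =
      covered-twice (bit a) (bit x) (bit y) (bit b) (bit c)
        (∈-one-of⇒T∨ (degree-two-covers (inner-degree P₂ (λ ()) (λ ()))
                        (first-edge P₂) (last-edge P₂) (SuspendedPath.ends≢ P₂) i))
        (∈-one-of⇒T∨ (degree-two-covers (inner-degree P₃ (λ ()) (λ ()))
                        (first-edge P₃) b~c (vtx-≢-start P₃ (λ ()) ∘ sym) i))
        (∈-one-of⇒T∨ (degree-two-covers (inner-degree P₃ (λ ()) (λ ()))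
                        (Adj-sym b~c) (last-edge P₃) (vtx-≢-end P₃ (λ ())) i))
      where
      open SuspendedPath using (vtx; edges)
      a b c : Fin n
      a = vtx P₂ (suc zero)
      b = vtx P₃ (suc zero)
      c = vtx P₃ (suc (suc zero))
      bit : Fin n → Bool
      bit v = lookup (col v) i
      b~c : Adj G b c
      b~c = edges P₃ (suc zero)

proposition12 : (G : Graph) → HasHammock G → FdomAtMost G 5 2
proposition12 G (_ , _ , _ , P₂ , P₃) p q _ _ D = begin
  p * 2                           ≤⟨ double-counting 2 (map col hammock)
                                                       (hammock-covered-twice G D P₂ P₃) ⟩
  sum (map ∣_∣ (map col hammock)) ≡⟨ sum-sizes G D hammock ⟩
  5 * q                           ∎
  where
  open ≤-Reasoning
  open DomColouring D using (col)
  hammock : Vec (Fin (Graph.n G)) 5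
  hammock = hammock-vertices G P₂ P₃
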